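{- Let $1\le a\le b\le c$ be integers, $K=K_{a,b,c}$ and $k=a+b+c$. Given $0<d\le 3/5$ and $\beta,\rho>0$, there exists $n_0$ such that the following holds. If every $3$-graph $H$ on $n>n_0$ vertices with $\delta_1(H)\ge d\binom n2$ has a $\beta$-deficient $K$-tiling, then every $3$-graph $H'$ on $n'>\max\{n_0,5\}$ vertices with $\delta_1(H')\ge(d-\rho)\binom{n'}2$ has a $(\beta+2k\rho)$-deficient $K$-tiling.
   Context: $\delta_1(H)$ is the minimum, over vertices $v$, of the number of edges containing $v$. A $K$-tiling of a $3$-graph $H$ on $n$ vertices is a collection of vertex-disjoint copies of $K$ in $H$; it is $\beta$-deficient if it covers all but at most $\beta n$ vertices of $H$. $K_{a,b,c}$ is the complete $3$-partite $3$-graph with parts of sizes $a,b,c$.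
   Formalization: The parameters d, β and ρ range over the rationals. -}

module Defs where

open import Data.Nat as ℕ using (ℕ; zero; suc; _<_; _∸_)
open import Data.Nat.Combinatorics using (_C_)
open import Data.Bool using (Bool; true; false)
open import Data.Fin using (Fin; toℕ)
open import Data.List using (List; []; _∷_; length; filter; concatMap; allFin; _++_)
open import Data.List.Relation.Unary.Unique.Propositional using (Unique)
open import Data.Vec as Vec using (Vec)
open import Data.Vec.Membership.Propositional as VM using ()
open import Data.Integer using (+_)
open import Data.Rational as ℚ using (ℚ; _/_; _≤_)
open import Data.Product using (_×_; _,_; Σ)
open import Relation.Binary.PropositionalEquality using (_≡_; _≢_)
open import Relation.Nullary using (Dec; yes; no)
open import Data.Nat.Properties using (_<?_)
open import Data.Bool using (T)

ℕ→ℚ : ℕ → ℚ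
ℕ→ℚ n = + n / 1

-- A 3-graph on vertex set Fin n: the edge indicator on ordered triples,
-- required to be symmetric and to vanish on triples with a repeated vertex,
-- so that it represents a set of 3-element subsets of Fin n.
record Graph3 (n : ℕ) : Set where
  field
    edge     : Fin n → Fin n → Fin n → Bool
    sym₁₂    : ∀ x y z → edge x y z ≡ edge y x z
    sym₂₃    : ∀ x y z → edge x y z ≡ edge x z y
    loop₁₂   : ∀ x z → edge x x z ≡ false
open Graph3 public

pairs : (n : ℕ) → List (Fin n × Fin n)
pairs n = concatMap (λ u → filter (λ w → toℕ u <? toℕ w) (allFin n) |> λ ws →
            Data.List.map (λ w → (u , w)) ws) (allFin n)
  where
  open import Function using (_|>_)
  import Data.List

degree : ∀ {n} → Graph3 n → Fin n → ℕ
degree {n} H v = length (filter (λ p → Data.Bool._≟_ (edge H v (Data.Product.proj₁ p) (Data.Product.proj₂ p)) true) (pairs n))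
  where import Data.Bool; import Data.Product

δ₁≥ : ∀ {n} → Graph3 n → ℚ → Set
δ₁≥ {n} H x = ∀ (v : Fin n) → x ≤ ℕ→ℚ (degree H v)

-- A copy of K_{a,b,c} in H: vertex lists A, B, C of sizes a, b, c
-- (pairwise distinct vertices, enforced in the tiling via Unique) such that
-- every triple with one vertex in each part is an edge of H.
record Copy {n} (H : Graph3 n) (a b c : ℕ) : Set where
  field
    partA : Vec (Fin n) a
    partB : Vec (Fin n) b
    partC : Vec (Fin n) c
    complete : ∀ {x y z} → x VM.∈ partA → y VM.∈ partB → z VM.∈ partC →
               edge H x y z ≡ true
open Copy public

copyVertices : ∀ {n} {H : Graph3 n} {a b c} → Copy H a b c → List (Fin n)
copyVertices K = Vec.toList (partA K) ++ Vec.toList (partB K) ++ Vec.toList (partC K)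

record Tiling {n} (H : Graph3 n) (a b c : ℕ) : Set where
  field
    copies   : List (Copy H a b c)
    disjoint : Unique (concatMap copyVertices copies)
open Tiling public

covered : ∀ {n} {H : Graph3 n} {a b c} → Tiling H a b c → ℕ
covered T = length (concatMap copyVertices (copies T))

Deficient : ∀ {n} {H : Graph3 n} {a b c} → ℚ → Tiling H a b c → Set
Deficient {n} β T = ℕ→ℚ (n ∸ covered T) ≤ β ℚ.* ℕ→ℚ n

HasDeficientTiling : ∀ {n} → Graph3 n → (a b c : ℕ) → ℚ → Set
HasDeficientTiling H a b c β = Σ (Tiling H a b c) (Deficient β)

-- Pad H′ (n vertices, δ₁ ≥ (d − ρ)·C(n,2)) with m ≈ (5/4)ρn + 2 cone vertices, each added vertex forming
-- an edge with every pair of vertices already present.  An old vertex gains (n − 1)m + C(m,2) ≥ ρ·C(n,2) + d·(nm + C(m,2))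
-- edges, and a new vertex has full degree C(n+m−1,2) ≥ (3/5)·C(n+m,2), so the padded graph meets the hypothesis
-- and has a β-deficient tiling.  Each new vertex spoils at most one copy; dropping those copies uncovers at most
-- km further vertices, which is at most 2kρn once ρn ≥ 24 (when β + 2kρ ≥ 1 the empty tiling suffices).

module Submission where

open import Defs

module Combinatorics where

  open import Data.Bool using (Bool; true; false; if_then_else_; _∧_)
  import Data.Bool as Bool
  open import Data.Empty using (⊥-elim)
  open import Data.Fin using (Fin; zero; suc; toℕ)
  import Data.Fin as Fin
  import Data.Fin.Properties as Fin
  open import Data.List using (List; []; _∷_; length; filter; concatMap; allFin; _++_; map)
  import Data.List.Properties as List
  open import Data.List.Membership.Propositional using (_∈_)
  import Data.List.Membership.Propositional.Properties as ∈
  open import Data.List.Relation.Binary.Disjoint.Propositional using (Disjoint)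
  open import Data.List.Relation.Unary.All as All using (All; []; _∷_)
  import Data.List.Relation.Unary.All.Properties as All
  open import Data.List.Relation.Unary.AllPairs using ([]; _∷_)
  open import Data.List.Relation.Unary.Any using (here; there)
  open import Data.List.Relation.Unary.Unique.Propositional using (Unique)
  import Data.List.Relation.Unary.Unique.Propositional.Properties as Unique
  open import Data.Nat as ℕ using (ℕ; zero; suc; _+_; _*_; _∸_; _≤_; z≤n; s≤s)
  open import Data.Nat.ListAction using (sum)
  open import Data.Nat.Combinatorics using (_C_; nCk+nC[k+1]≡[n+1]C[k+1]; nC1≡n)
  open import Data.Nat.Properties
  open import Data.Nat.Tactic.RingSolver using (solve-∀)
  open import Data.Product using (_×_; _,_; Σ; ∃; uncurry)
  open import Data.Sum using (inj₁; inj₂)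
  open import Data.Vec as Vec using (Vec)
  import Data.Vec.Properties as Vec
  import Data.Vec.Membership.Propositional as Vec
  import Data.Vec.Membership.Propositional.Properties as Vec
  import Data.Vec.Relation.Unary.Any.Properties as VecAny
  open import Function using (_∘_)
  open import Relation.Binary.PropositionalEquality
  open import Relation.Nullary using (Dec; yes; no; does)

  [1+n]C2≡n+nC2 : ∀ n → suc n C 2 ≡ n + n C 2
  [1+n]C2≡n+nC2 n = trans (sym (nCk+nC[k+1]≡[n+1]C[k+1] n 1)) (cong (_+ n C 2) (nC1≡n n))

  2*[1+n]C2≡[1+n]*n : ∀ n → 2 * (suc n C 2) ≡ suc n * n
  2*[1+n]C2≡[1+n]*n zero = refl
  2*[1+n]C2≡[1+n]*n (suc n) = begin
    2 * (suc (suc n) C 2)      ≡⟨ cong (2 *_) ([1+n]C2≡n+nC2 (suc n)) ⟩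
    2 * (suc n + suc n C 2)    ≡⟨ *-distribˡ-+ 2 (suc n) _ ⟩
    2 * suc n + 2 * (suc n C 2) ≡⟨ cong (2 * suc n +_) (2*[1+n]C2≡[1+n]*n n) ⟩
    2 * suc n + suc n * n      ≡⟨ ring n ⟩
    suc (suc n) * suc n        ∎
    where
    open ≡-Reasoning
    ring : ∀ n → 2 * suc n + suc n * n ≡ suc (suc n) * suc n
    ring = solve-∀

  [m+n]C2≡nC2+n*m+mC2 : ∀ m n → (m + n) C 2 ≡ n C 2 + n * m + m C 2
  [m+n]C2≡nC2+n*m+mC2 zero n =
    sym (trans (+-identityʳ _) (trans (cong (n C 2 +_) (*-zeroʳ n)) (+-identityʳ (n C 2))))
  [m+n]C2≡nC2+n*m+mC2 (suc m) n = begin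
    suc (m + n) C 2                      ≡⟨ [1+n]C2≡n+nC2 (m + n) ⟩
    (m + n) + (m + n) C 2                ≡⟨ cong ((m + n) +_) ([m+n]C2≡nC2+n*m+mC2 m n) ⟩
    (m + n) + (n C 2 + n * m + m C 2)    ≡⟨ ring m n (n C 2) (m C 2) ⟩
    n C 2 + n * suc m + (m + m C 2)      ≡⟨ cong (n C 2 + n * suc m +_) (sym ([1+n]C2≡n+nC2 m)) ⟩
    n C 2 + n * suc m + suc m C 2        ∎
    where
    open ≡-Reasoning
    ring : ∀ m n x y → (m + n) + (x + n * m + y) ≡ x + n * suc m + (m + y)
    ring = solve-∀

  3*[1+n]C2≤5*nC2 : ∀ n → 5 ≤ n → 3 * (suc n C 2) ≤ 5 * (n C 2)
  3*[1+n]C2≤5*nC2 (suc n) 5≤1+n = begin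
    3 * (suc (suc n) C 2)       ≡⟨ cong (3 *_) ([1+n]C2≡n+nC2 (suc n)) ⟩
    3 * (suc n + suc n C 2)     ≡⟨ *-distribˡ-+ 3 (suc n) _ ⟩
    3 * suc n + 3 * (suc n C 2) ≤⟨ +-monoˡ-≤ (3 * (suc n C 2)) 3[1+n]≤2*[1+n]C2 ⟩
    2 * (suc n C 2) + 3 * (suc n C 2) ≡⟨ sym (*-distribʳ-+ (suc n C 2) 2 3) ⟩
    5 * (suc n C 2)             ∎
    where
    open ≤-Reasoning
    3[1+n]≤2*[1+n]C2 : 3 * suc n ≤ 2 * (suc n C 2)
    3[1+n]≤2*[1+n]C2 = begin
      3 * suc n ≡⟨ *-comm 3 (suc n) ⟩
      suc n * 3 ≤⟨ *-monoʳ-≤ (suc n) (≤-pred (≤-trans (s≤s (s≤s (s≤s (s≤s z≤n)))) 5≤1+n)) ⟩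
      suc n * n ≡⟨ sym (2*[1+n]C2≡[1+n]*n n) ⟩
      2 * (suc n C 2) ∎

  countᵇ : {A : Set} → (A → Bool) → List A → ℕ
  countᵇ p [] = 0
  countᵇ p (x ∷ xs) = if p x then suc (countᵇ p xs) else countᵇ p xs

  module _ {A : Set} where

    length-filter≡countᵇ : (p : A → Bool) (xs : List A) → length (filter (λ x → p x Bool.≟ true) xs) ≡ countᵇ p xs
    length-filter≡countᵇ p [] = refl
    length-filter≡countᵇ p (x ∷ xs) with p x
    ... | true  = cong suc (length-filter≡countᵇ p xs)
    ... | false = length-filter≡countᵇ p xs

    countᵇ-++ : (p : A → Bool) (xs ys : List A) → countᵇ p (xs ++ ys) ≡ countᵇ p xs + countᵇ p ys
    countᵇ-++ p [] ys = refl
    countᵇ-++ p (x ∷ xs) ys with p x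
    ... | true  = cong suc (countᵇ-++ p xs ys)
    ... | false = countᵇ-++ p xs ys

    countᵇ-filter : {P : A → Set} (P? : ∀ x → Dec (P x)) (p : A → Bool) (xs : List A) →
                    countᵇ p (filter P? xs) ≡ countᵇ (λ x → does (P? x) ∧ p x) xs
    countᵇ-filter P? p [] = refl
    countᵇ-filter P? p (x ∷ xs) with P? x
    ... | no _ = countᵇ-filter P? p xs
    ... | yes _ with p x
    ...   | true  = cong suc (countᵇ-filter P? p xs)
    ...   | false = countᵇ-filter P? p xs

    countᵇ-cong : {p q : A → Bool} → (∀ x → p x ≡ q x) → ∀ xs → countᵇ p xs ≡ countᵇ q xs
    countᵇ-cong p≗q [] = refl
    countᵇ-cong {q = q} p≗q (x ∷ xs) rewrite p≗q x with q x
    ... | true  = cong suc (countᵇ-cong p≗q xs)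
    ... | false = countᵇ-cong p≗q xs

    countᵇ-true : (xs : List A) → countᵇ (λ _ → true) xs ≡ length xs
    countᵇ-true [] = refl
    countᵇ-true (x ∷ xs) = cong suc (countᵇ-true xs)

    countᵇ-false : (xs : List A) → countᵇ (λ _ → false) xs ≡ 0
    countᵇ-false [] = refl
    countᵇ-false (x ∷ xs) = countᵇ-false xs

    countᵇ≡0⇒All : (p : A → Bool) (xs : List A) → countᵇ p xs ≡ 0 → All (λ x → p x ≡ false) xs
    countᵇ≡0⇒All p [] _ = []
    countᵇ≡0⇒All p (x ∷ xs) none with p x in px
    ... | false = px ∷ countᵇ≡0⇒All p xs none

  countᵇ-map : {A B : Set} (p : B → Bool) (f : A → B) (xs : List A) → countᵇ p (map f xs) ≡ countᵇ (p ∘ f) xs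
  countᵇ-map p f [] = refl
  countᵇ-map p f (x ∷ xs) with p (f x)
  ... | true  = cong suc (countᵇ-map p f xs)
  ... | false = countᵇ-map p f xs

  countᵇ-concatMap : {A B : Set} (p : B → Bool) (f : A → List B) (xs : List A) →
                     countᵇ p (concatMap f xs) ≡ sum (map (countᵇ p ∘ f) xs)
  countᵇ-concatMap p f [] = refl
  countᵇ-concatMap p f (x ∷ xs) =
    trans (countᵇ-++ p (f x) (concatMap f xs)) (cong (countᵇ p (f x) +_) (countᵇ-concatMap p f xs))

  pairCount : (n : ℕ) → (Fin n → Fin n → Bool) → ℕ
  pairCount n g = countᵇ (uncurry g) (pairs n)

  rowCount : (n : ℕ) → (Fin n → Fin n → Bool) → Fin n → ℕ
  rowCount n g u = countᵇ (λ w → does (toℕ u <? toℕ w) ∧ g u w) (allFin n)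

  degree≡pairCount : ∀ {n} (H : Graph3 n) v → degree H v ≡ pairCount n (edge H v)
  degree≡pairCount {n} H v = length-filter≡countᵇ (uncurry (edge H v)) (pairs n)

  pairCount≡sum-rowCount : ∀ n g → pairCount n g ≡ sum (map (rowCount n g) (allFin n))
  pairCount≡sum-rowCount n g =
    trans (countᵇ-concatMap _ _ (allFin n)) (cong sum (List.map-cong row (allFin n)))
    where
    row : ∀ u → _ ≡ rowCount n g u
    row u = trans (countᵇ-map (uncurry g) (u ,_) (filter (λ w → toℕ u <? toℕ w) (allFin n)))
                  (countᵇ-filter (λ w → toℕ u <? toℕ w) (g u) (allFin n))

  allFin-suc : ∀ n → allFin (suc n) ≡ zero ∷ map suc (allFin n)
  allFin-suc n = cong (zero ∷_) (sym (List.map-tabulate (λ i → i) suc))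

  rowCount-zero : ∀ n g → rowCount (suc n) g zero ≡ countᵇ (g zero ∘ suc) (allFin n)
  rowCount-zero n g = trans (cong (countᵇ p) (allFin-suc n)) (countᵇ-map p Fin.suc (allFin n))
    where p = λ w → does (0 <? toℕ w) ∧ g zero w

  rowCount-suc : ∀ n g u → rowCount (suc n) g (suc u) ≡ rowCount n (λ x y → g (suc x) (suc y)) u
  rowCount-suc n g u = trans (cong (countᵇ p) (allFin-suc n)) (countᵇ-map p Fin.suc (allFin n))
    where p = λ w → does (suc (toℕ u) <? toℕ w) ∧ g (suc u) w

  pairCount-suc : ∀ n g → pairCount (suc n) g ≡
                  countᵇ (g zero ∘ suc) (allFin n) + pairCount n (λ x y → g (suc x) (suc y))
  pairCount-suc n g = begin
    pairCount (suc n) g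
      ≡⟨ pairCount≡sum-rowCount (suc n) g ⟩
    sum (map (rowCount (suc n) g) (allFin (suc n)))
      ≡⟨ cong (sum ∘ map (rowCount (suc n) g)) (allFin-suc n) ⟩
    rowCount (suc n) g zero + sum (map (rowCount (suc n) g) (map suc (allFin n)))
      ≡⟨ cong₂ _+_ (rowCount-zero n g) (cong sum (trans (sym (List.map-∘ (allFin n))) (List.map-cong (rowCount-suc n g) (allFin n)))) ⟩
    countᵇ (g zero ∘ suc) (allFin n) + sum (map (rowCount n g′) (allFin n))
      ≡⟨ cong (countᵇ (g zero ∘ suc) (allFin n) +_) (sym (pairCount≡sum-rowCount n g′)) ⟩
    countᵇ (g zero ∘ suc) (allFin n) + pairCount n g′ ∎
    where
    open ≡-Reasoning
    g′ = λ x y → g (suc x) (suc y)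

  pairCount-complete : ∀ n (g : Fin n → Fin n → Bool) → (∀ u w → u ≢ w → g u w ≡ true) → pairCount n g ≡ n C 2
  pairCount-complete zero g _ = refl
  pairCount-complete (suc n) g complete = begin
    pairCount (suc n) g
      ≡⟨ pairCount-suc n g ⟩
    countᵇ (g zero ∘ suc) (allFin n) + pairCount n (λ x y → g (suc x) (suc y))
      ≡⟨ cong₂ _+_ zero-row (pairCount-complete n _ λ u w u≢w → complete (suc u) (suc w) (u≢w ∘ Fin.suc-injective)) ⟩
    n + n C 2
      ≡⟨ sym ([1+n]C2≡n+nC2 n) ⟩
    suc n C 2 ∎
    where
    open ≡-Reasoning
    zero-row : countᵇ (g zero ∘ suc) (allFin n) ≡ n
    zero-row = trans (countᵇ-cong (λ w → complete zero (suc w) (λ ())) (allFin n))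
                     (trans (countᵇ-true (allFin n)) (List.length-tabulate (λ i → i)))

  -- Cones: adding one vertex that forms an edge with every pair of distinct old vertices

  _≢ᵇ_ : ∀ {n} → Fin n → Fin n → Bool
  zero  ≢ᵇ zero  = false
  zero  ≢ᵇ suc _ = true
  suc _ ≢ᵇ zero  = true
  suc u ≢ᵇ suc w = u ≢ᵇ w

  ≢ᵇ-irrefl : ∀ {n} (u : Fin n) → (u ≢ᵇ u) ≡ false
  ≢ᵇ-irrefl zero    = refl
  ≢ᵇ-irrefl (suc u) = ≢ᵇ-irrefl u

  ≢ᵇ-sym : ∀ {n} (u w : Fin n) → (u ≢ᵇ w) ≡ (w ≢ᵇ u)
  ≢ᵇ-sym zero    zero    = refl
  ≢ᵇ-sym zero    (suc w) = refl
  ≢ᵇ-sym (suc u) zero    = refl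
  ≢ᵇ-sym (suc u) (suc w) = ≢ᵇ-sym u w

  ≢⇒≢ᵇ : ∀ {n} (u w : Fin n) → u ≢ w → (u ≢ᵇ w) ≡ true
  ≢⇒≢ᵇ zero    zero    u≢w = ⊥-elim (u≢w refl)
  ≢⇒≢ᵇ zero    (suc w) _   = refl
  ≢⇒≢ᵇ (suc u) zero    _   = refl
  ≢⇒≢ᵇ (suc u) (suc w) u≢w = ≢⇒≢ᵇ u w (u≢w ∘ cong suc)

  countᵇ-≢ᵇ : ∀ {n} (v : Fin (suc n)) → countᵇ (v ≢ᵇ_) (allFin (suc n)) ≡ n
  countᵇ-≢ᵇ {n} zero = begin
    countᵇ (zero ≢ᵇ_) (allFin (suc n))  ≡⟨ cong (countᵇ (zero ≢ᵇ_)) (allFin-suc n) ⟩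
    countᵇ (zero ≢ᵇ_) (map suc (allFin n)) ≡⟨ countᵇ-map (zero ≢ᵇ_) Fin.suc (allFin n) ⟩
    countᵇ (λ _ → true) (allFin n)      ≡⟨ countᵇ-true (allFin n) ⟩
    length (allFin n)                   ≡⟨ List.length-tabulate (λ i → i) ⟩
    n                                   ∎
    where open ≡-Reasoning
  countᵇ-≢ᵇ {suc n} (suc v) = begin
    countᵇ (suc v ≢ᵇ_) (allFin (suc (suc n)))       ≡⟨ cong (countᵇ (suc v ≢ᵇ_)) (allFin-suc (suc n)) ⟩
    suc (countᵇ (suc v ≢ᵇ_) (map suc (allFin (suc n)))) ≡⟨ cong suc (countᵇ-map (suc v ≢ᵇ_) Fin.suc (allFin (suc n))) ⟩
    suc (countᵇ (v ≢ᵇ_) (allFin (suc n)))           ≡⟨ cong suc (countᵇ-≢ᵇ v) ⟩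
    suc n                                           ∎
    where open ≡-Reasoning

  module _ {n : ℕ} (G : Graph3 n) where

    coneEdge : Fin (suc n) → Fin (suc n) → Fin (suc n) → Bool
    coneEdge zero    zero    _       = false
    coneEdge zero    (suc u) zero    = false
    coneEdge zero    (suc u) (suc w) = u ≢ᵇ w
    coneEdge (suc v) zero    zero    = false
    coneEdge (suc v) zero    (suc w) = v ≢ᵇ w
    coneEdge (suc v) (suc u) zero    = v ≢ᵇ u
    coneEdge (suc v) (suc u) (suc w) = edge G v u w

    coneEdge-sym₁₂ : ∀ x y z → coneEdge x y z ≡ coneEdge y x z
    coneEdge-sym₁₂ zero    zero    z       = refl
    coneEdge-sym₁₂ zero    (suc u) zero    = refl
    coneEdge-sym₁₂ zero    (suc u) (suc w) = refl
    coneEdge-sym₁₂ (suc v) zero    zero    = refl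
    coneEdge-sym₁₂ (suc v) zero    (suc w) = refl
    coneEdge-sym₁₂ (suc v) (suc u) zero    = ≢ᵇ-sym v u
    coneEdge-sym₁₂ (suc v) (suc u) (suc w) = sym₁₂ G v u w

    coneEdge-sym₂₃ : ∀ x y z → coneEdge x y z ≡ coneEdge x z y
    coneEdge-sym₂₃ zero    zero    zero    = refl
    coneEdge-sym₂₃ zero    zero    (suc w) = refl
    coneEdge-sym₂₃ zero    (suc u) zero    = refl
    coneEdge-sym₂₃ zero    (suc u) (suc w) = ≢ᵇ-sym u w
    coneEdge-sym₂₃ (suc v) zero    zero    = refl
    coneEdge-sym₂₃ (suc v) zero    (suc w) = refl
    coneEdge-sym₂₃ (suc v) (suc u) zero    = refl
    coneEdge-sym₂₃ (suc v) (suc u) (suc w) = sym₂₃ G v u w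

    coneEdge-loop₁₂ : ∀ x z → coneEdge x x z ≡ false
    coneEdge-loop₁₂ zero    z       = refl
    coneEdge-loop₁₂ (suc v) zero    = ≢ᵇ-irrefl v
    coneEdge-loop₁₂ (suc v) (suc w) = loop₁₂ G v w

    cone : Graph3 (suc n)
    cone = record
      { edge = coneEdge ; sym₁₂ = coneEdge-sym₁₂ ; sym₂₃ = coneEdge-sym₂₃ ; loop₁₂ = coneEdge-loop₁₂ }

    degree-cone-apex : degree cone zero ≡ n C 2
    degree-cone-apex = begin
      degree cone zero                                      ≡⟨ degree≡pairCount cone zero ⟩
      pairCount (suc n) (coneEdge zero)                     ≡⟨ pairCount-suc n (coneEdge zero) ⟩
      countᵇ (λ _ → false) (allFin n) + pairCount n _≢ᵇ_    ≡⟨ cong₂ _+_ (countᵇ-false (allFin n)) (pairCount-complete n _≢ᵇ_ ≢⇒≢ᵇ) ⟩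
      n C 2                                                 ∎
      where open ≡-Reasoning

  degree-cone-suc : ∀ {n} (G : Graph3 (suc n)) v → degree (cone G) (suc v) ≡ n + degree G v
  degree-cone-suc {n} G v = begin
    degree (cone G) (suc v)                            ≡⟨ degree≡pairCount (cone G) (suc v) ⟩
    pairCount (suc (suc n)) (coneEdge G (suc v))       ≡⟨ pairCount-suc (suc n) (coneEdge G (suc v)) ⟩
    countᵇ (v ≢ᵇ_) (allFin (suc n)) + pairCount (suc n) (edge G v) ≡⟨ cong₂ _+_ (countᵇ-≢ᵇ v) (sym (degree≡pairCount G v)) ⟩
    n + degree G v                                     ∎
    where open ≡-Reasoning

  predecessors : ∀ {n} → List (Fin (suc n)) → List (Fin n)
  predecessors []           = []
  predecessors (zero  ∷ xs) = predecessors xs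
  predecessors (suc v ∷ xs) = v ∷ predecessors xs

  ∈-predecessors⁻ : ∀ {n} (xs : List (Fin (suc n))) {v} → v ∈ predecessors xs → suc v ∈ xs
  ∈-predecessors⁻ (zero  ∷ xs) v∈ = there (∈-predecessors⁻ xs v∈)
  ∈-predecessors⁻ (suc w ∷ xs) (here refl) = here refl
  ∈-predecessors⁻ (suc w ∷ xs) (there v∈) = there (∈-predecessors⁻ xs v∈)

  predecessors-unique : ∀ {n} (xs : List (Fin (suc n))) → Unique xs → Unique (predecessors xs)
  predecessors-unique []           _ = []
  predecessors-unique (zero  ∷ xs) (_ ∷ u) = predecessors-unique xs u
  predecessors-unique (suc v ∷ xs) (v∉ ∷ u) =
    All.tabulate (λ w∈ v≡w → All.lookup v∉ (∈-predecessors⁻ xs w∈) (cong suc v≡w)) ∷ predecessors-unique xs u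

  length-predecessors : ∀ {n} (xs : List (Fin (suc n))) → Unique xs → length xs ≤ suc (length (predecessors xs))
  length-predecessors []           _ = z≤n
  length-predecessors (zero  ∷ xs) (0∉ ∷ _) = s≤s (nonzero xs 0∉)
    where
    nonzero : ∀ {n} (xs : List (Fin (suc n))) → All (zero ≢_) xs → length xs ≤ length (predecessors xs)
    nonzero []           _ = z≤n
    nonzero (zero  ∷ xs) (0≢0 ∷ _) = ⊥-elim (0≢0 refl)
    nonzero (suc v ∷ xs) (_ ∷ 0∉) = s≤s (nonzero xs 0∉)
  length-predecessors (suc v ∷ xs) (_ ∷ u) = s≤s (length-predecessors xs u)

  -- Iterated cones: in tower j the new vertices are 0, …, j − 1 and the old vertex u sits at j + u.

  module Tower {N : ℕ} (H : Graph3 (suc N)) where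

    tower : (j : ℕ) → Graph3 (suc (j + N))
    tower zero    = H
    tower (suc j) = cone (tower j)

    embed : (j : ℕ) → Fin (suc N) → Fin (suc (j + N))
    embed zero    x = x
    embed (suc j) x = suc (embed j x)

    isNew : (j : ℕ) → Fin (suc (j + N)) → Bool
    isNew zero    _       = false
    isNew (suc j) zero    = true
    isNew (suc j) (suc v) = isNew j v

    retract : (j : ℕ) → Fin (suc (j + N)) → Fin (suc N)
    retract zero    v       = v
    retract (suc j) zero    = zero
    retract (suc j) (suc v) = retract j v

    edge-embed : ∀ j x y z → edge (tower j) (embed j x) (embed j y) (embed j z) ≡ edge H x y z
    edge-embed zero    x y z = refl
    edge-embed (suc j) x y z = edge-embed j x y z

    embed-retract : ∀ j v → isNew j v ≡ false → embed j (retract j v) ≡ v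
    embed-retract zero    v       _   = refl
    embed-retract (suc j) zero    ()
    embed-retract (suc j) (suc v) old = cong suc (embed-retract j v old)

    degree-embed : ∀ j u → degree (tower j) (embed j u) ≡ degree H u + (j * N + j C 2)
    degree-embed zero    u = sym (+-identityʳ (degree H u))
    degree-embed (suc j) u = begin
      degree (tower (suc j)) (embed (suc j) u)  ≡⟨ degree-cone-suc (tower j) (embed j u) ⟩
      (j + N) + degree (tower j) (embed j u)    ≡⟨ cong ((j + N) +_) (degree-embed j u) ⟩
      (j + N) + (degree H u + (j * N + j C 2))  ≡⟨ ring j N (degree H u) (j C 2) ⟩
      degree H u + (suc j * N + (j + j C 2))    ≡⟨ cong (λ t → degree H u + (suc j * N + t)) (sym ([1+n]C2≡n+nC2 j)) ⟩
      degree H u + (suc j * N + suc j C 2)      ∎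
      where
      open ≡-Reasoning
      ring : ∀ j N d c → (j + N) + (d + (j * N + c)) ≡ d + (suc j * N + (j + c))
      ring = solve-∀

    degree-new : ∀ j v → isNew j v ≡ true → degree (tower j) v ≡ (j + N) C 2
    degree-new (suc j) zero    _   = degree-cone-apex (tower j)
    degree-new (suc j) (suc v) new = begin
      degree (tower (suc j)) (suc v)  ≡⟨ degree-cone-suc (tower j) v ⟩
      (j + N) + degree (tower j) v    ≡⟨ cong ((j + N) +_) (degree-new j v new) ⟩
      (j + N) + (j + N) C 2           ≡⟨ sym ([1+n]C2≡n+nC2 (j + N)) ⟩
      suc (j + N) C 2                 ∎
      where open ≡-Reasoning

    length-unique-new : ∀ j xs → Unique xs → All (λ v → isNew j v ≡ true) xs → length xs ≤ j
    length-unique-new zero    []      _ _        = z≤n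
    length-unique-new zero    (_ ∷ _) _ (() ∷ _)
    length-unique-new (suc j) xs      u new =
      ≤-trans (length-predecessors xs u)
              (s≤s (length-unique-new j (predecessors xs) (predecessors-unique xs u) (predecessors-new xs new)))
      where
      predecessors-new : ∀ xs → All (λ v → isNew (suc j) v ≡ true) xs → All (λ v → isNew j v ≡ true) (predecessors xs)
      predecessors-new []           _ = []
      predecessors-new (zero  ∷ xs) (_ ∷ new) = predecessors-new xs new
      predecessors-new (suc v ∷ xs) (p ∷ new) = p ∷ predecessors-new xs new

  -- Restricting a tiling to an induced subhypergraph

  length-copyVertices : ∀ {n} {G : Graph3 n} {a b c} (K : Copy G a b c) → length (copyVertices K) ≡ a + b + c
  length-copyVertices {a = a} {b} {c} K = begin
    length (Vec.toList (partA K) ++ Vec.toList (partB K) ++ Vec.toList (partC K))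
      ≡⟨ List.length-++ (Vec.toList (partA K)) ⟩
    length (Vec.toList (partA K)) + length (Vec.toList (partB K) ++ Vec.toList (partC K))
      ≡⟨ cong₂ _+_ (Vec.length-toList (partA K))
                   (trans (List.length-++ (Vec.toList (partB K))) (cong₂ _+_ (Vec.length-toList (partB K)) (Vec.length-toList (partC K)))) ⟩
    a + (b + c) ≡⟨ sym (+-assoc a b c) ⟩
    a + b + c   ∎
    where open ≡-Reasoning

  length-concatMap-copyVertices : ∀ {n} {G : Graph3 n} {a b c} (Ks : List (Copy G a b c)) → length (concatMap copyVertices Ks) ≡ (a + b + c) * length Ks
  length-concatMap-copyVertices {a = a} {b} {c} []       = sym (*-zeroʳ (a + b + c))
  length-concatMap-copyVertices {a = a} {b} {c} (K ∷ Ks) =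
    trans (List.length-++ (copyVertices K))
          (trans (cong₂ _+_ (length-copyVertices K) (length-concatMap-copyVertices Ks)) (sym (*-suc (a + b + c) (length Ks))))

  Unique-++⁻ : {A : Set} (xs : List A) {ys : List A} → Unique (xs ++ ys) → Unique xs × Unique ys × Disjoint xs ys
  Unique-++⁻ []       u = [] , u , λ ()
  Unique-++⁻ (x ∷ xs) (x∉ ∷ u) with Unique-++⁻ xs u
  ... | uxs , uys , xs#ys = All.++⁻ˡ xs x∉ ∷ uxs , uys , x∷xs#ys
    where
    x∷xs#ys : Disjoint (x ∷ xs) _
    x∷xs#ys (here refl  , v∈ys) = All.lookup (All.++⁻ʳ xs x∉) v∈ys refl
    x∷xs#ys (there v∈xs , v∈ys) = xs#ys (v∈xs , v∈ys)

  module Restriction {n′ n : ℕ} {H′ : Graph3 n′} {G : Graph3 n} {a b c : ℕ}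
    (embed : Fin n′ → Fin n) (isNew : Fin n → Bool) (retract : Fin n → Fin n′)
    (edge-embed : ∀ x y z → edge G (embed x) (embed y) (embed z) ≡ edge H′ x y z)
    (embed-retract : ∀ v → isNew v ≡ false → embed (retract v) ≡ v) where

    Old : Fin n → Set
    Old v = isNew v ≡ false

    restrictCopy : (K : Copy G a b c) → All Old (copyVertices K) → Copy H′ a b c
    restrictCopy K old = record
      { partA = Vec.map retract (partA K)
      ; partB = Vec.map retract (partB K)
      ; partC = Vec.map retract (partC K)
      ; complete = complete′ }
      where
      preimage : ∀ {k y} {xs : Vec (Fin n) k} → y Vec.∈ Vec.map retract xs → ∃ λ x → x Vec.∈ xs × y ≡ retract x
      preimage = Vec.fromAny ∘ VecAny.map⁻
      oldA : ∀ {x} → x Vec.∈ partA K → Old x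
      oldA x∈ = All.lookup old (∈.∈-++⁺ˡ (Vec.∈-toList⁺ x∈))
      oldB : ∀ {x} → x Vec.∈ partB K → Old x
      oldB x∈ = All.lookup old (∈.∈-++⁺ʳ (Vec.toList (partA K)) (∈.∈-++⁺ˡ (Vec.∈-toList⁺ x∈)))
      oldC : ∀ {x} → x Vec.∈ partC K → Old x
      oldC x∈ = All.lookup old (∈.∈-++⁺ʳ (Vec.toList (partA K)) (∈.∈-++⁺ʳ (Vec.toList (partB K)) (Vec.∈-toList⁺ x∈)))
      complete′ : ∀ {x y z} → x Vec.∈ Vec.map retract (partA K) → y Vec.∈ Vec.map retract (partB K) →
                  z Vec.∈ Vec.map retract (partC K) → edge H′ x y z ≡ true
      complete′ x∈ y∈ z∈ with preimage x∈ | preimage y∈ | preimage z∈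
      ... | x , x∈A , refl | y , y∈B , refl | z , z∈K , refl = begin
        edge H′ (retract x) (retract y) (retract z)
          ≡⟨ sym (edge-embed (retract x) (retract y) (retract z)) ⟩
        edge G (embed (retract x)) (embed (retract y)) (embed (retract z))
          ≡⟨ cong₃ (edge G) (embed-retract x (oldA x∈A)) (embed-retract y (oldB y∈B)) (embed-retract z (oldC z∈K)) ⟩
        edge G x y z
          ≡⟨ complete K x∈A y∈B z∈K ⟩
        true ∎
        where
        open ≡-Reasoning
        cong₃ : ∀ {A B C D : Set} (f : A → B → C → D) {x x′ y y′ z z′} → x ≡ x′ → y ≡ y′ → z ≡ z′ → f x y z ≡ f x′ y′ z′
        cong₃ f refl refl refl = refl

    copyVertices-restrictCopy : (K : Copy G a b c) (old : All Old (copyVertices K)) →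
                                copyVertices (restrictCopy K old) ≡ map retract (copyVertices K)
    copyVertices-restrictCopy K old = begin
      Vec.toList (Vec.map retract (partA K)) ++ Vec.toList (Vec.map retract (partB K)) ++ Vec.toList (Vec.map retract (partC K))
        ≡⟨ cong₂ _++_ (Vec.toList-map retract (partA K)) (cong₂ _++_ (Vec.toList-map retract (partB K)) (Vec.toList-map retract (partC K))) ⟩
      map retract (Vec.toList (partA K)) ++ map retract (Vec.toList (partB K)) ++ map retract (Vec.toList (partC K))
        ≡⟨ cong (map retract (Vec.toList (partA K)) ++_) (sym (List.map-++ retract (Vec.toList (partB K)) _)) ⟩
      map retract (Vec.toList (partA K)) ++ map retract (Vec.toList (partB K) ++ Vec.toList (partC K))
        ≡⟨ sym (List.map-++ retract (Vec.toList (partA K)) _) ⟩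
      map retract (copyVertices K) ∎
      where open ≡-Reasoning

    newCount : Copy G a b c → ℕ
    newCount K = countᵇ isNew (copyVertices K)

    newCount≡0⇒allOld : ∀ K → newCount K ≡ 0 → All Old (copyVertices K)
    newCount≡0⇒allOld K = countᵇ≡0⇒All isNew (copyVertices K)

    oldCopies : List (Copy G a b c) → List (Copy H′ a b c)
    oldCopies [] = []
    oldCopies (K ∷ Ks) with newCount K ℕ.≟ 0
    ... | yes none = restrictCopy K (newCount≡0⇒allOld K none) ∷ oldCopies Ks
    ... | no _     = oldCopies Ks

    length-oldCopies : ∀ Ks → length Ks ≤ length (oldCopies Ks) + countᵇ isNew (concatMap copyVertices Ks)
    length-oldCopies [] = z≤n
    length-oldCopies (K ∷ Ks)
      rewrite countᵇ-++ isNew (copyVertices K) (concatMap copyVertices Ks) with newCount K ℕ.≟ 0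
    ... | yes _ = s≤s (≤-trans (length-oldCopies Ks) (+-monoʳ-≤ (length (oldCopies Ks)) (m≤n+m _ (newCount K))))
    ... | no some = begin
      suc (length Ks)                                  ≤⟨ s≤s (length-oldCopies Ks) ⟩
      suc (length (oldCopies Ks) + rest)               ≡⟨ sym (+-suc _ rest) ⟩
      length (oldCopies Ks) + suc rest                 ≤⟨ +-monoʳ-≤ (length (oldCopies Ks)) (+-monoˡ-≤ rest (n≢0⇒n>0 some)) ⟩
      length (oldCopies Ks) + (newCount K + rest)      ∎
      where
      open ≤-Reasoning
      rest = countᵇ isNew (concatMap copyVertices Ks)

    ∈-restrictCopy⁻ : ∀ K old {y} → y ∈ copyVertices (restrictCopy K old) → embed y ∈ copyVertices K
    ∈-restrictCopy⁻ K old {y} y∈ with ∈.∈-map⁻ retract (subst (y ∈_) (copyVertices-restrictCopy K old) y∈)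
    ... | x , x∈ , refl = subst (_∈ copyVertices K) (sym (embed-retract x (All.lookup old x∈))) x∈

    ∈-oldCopies⁻ : ∀ Ks {y} → y ∈ concatMap copyVertices (oldCopies Ks) → embed y ∈ concatMap copyVertices Ks
    ∈-oldCopies⁻ (K ∷ Ks) y∈ with newCount K ℕ.≟ 0
    ... | no _ = ∈.∈-++⁺ʳ (copyVertices K) (∈-oldCopies⁻ Ks y∈)
    ... | yes none with ∈.∈-++⁻ (copyVertices (restrictCopy K (newCount≡0⇒allOld K none))) y∈
    ...   | inj₁ y∈K  = ∈.∈-++⁺ˡ (∈-restrictCopy⁻ K (newCount≡0⇒allOld K none) y∈K)
    ...   | inj₂ y∈Ks = ∈.∈-++⁺ʳ (copyVertices K) (∈-oldCopies⁻ Ks y∈Ks)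

    map-embed-retract : ∀ xs → All Old xs → map embed (map retract xs) ≡ xs
    map-embed-retract []       []           = refl
    map-embed-retract (x ∷ xs) (old ∷ olds) = cong₂ _∷_ (embed-retract x old) (map-embed-retract xs olds)

    oldCopies-disjoint : ∀ Ks → Unique (concatMap copyVertices Ks) → Unique (concatMap copyVertices (oldCopies Ks))
    oldCopies-disjoint []       _ = []
    oldCopies-disjoint (K ∷ Ks) u with newCount K ℕ.≟ 0 | Unique-++⁻ (copyVertices K) u
    ... | no _     | _ , uKs , _ = oldCopies-disjoint Ks uKs
    ... | yes none | uK , uKs , K#Ks = Unique.++⁺ uK′ (oldCopies-disjoint Ks uKs)
          λ (y∈K , y∈Ks) → K#Ks (∈-restrictCopy⁻ K old y∈K , ∈-oldCopies⁻ Ks y∈Ks)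
      where
      old = newCount≡0⇒allOld K none
      uK′ : Unique (copyVertices (restrictCopy K old))
      uK′ = subst Unique (sym (copyVertices-restrictCopy K old))
              (Unique.map⁻ (subst Unique (sym (map-embed-retract (copyVertices K) old)) uK))

    -- Every discarded copy contains a new vertex and copies are disjoint, so at most m copies are lost.
    restrictTiling : (m : ℕ) → (∀ xs → Unique xs → All (λ v → isNew v ≡ true) xs → length xs ≤ m) →
                     (T : Tiling G a b c) → Σ (Tiling H′ a b c) λ T′ → covered T ≤ covered T′ + (a + b + c) * m
    restrictTiling m few-new T = T′ , covered-bound
      where
      k = a + b + c
      Ks = copies T
      T′ : Tiling H′ a b c
      T′ = record { copies = oldCopies Ks ; disjoint = oldCopies-disjoint Ks (disjoint T) }
      newTotal = countᵇ isNew (concatMap copyVertices Ks)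
      newTotal≤m : newTotal ≤ m
      newTotal≤m = subst (_≤ m) (length-filter≡countᵇ isNew vertices)
        (few-new _ (Unique.filter⁺ new? (disjoint T)) (All.all-filter new? vertices))
        where
        vertices = concatMap copyVertices Ks
        new? = λ v → isNew v Bool.≟ true
      covered-bound : covered T ≤ covered T′ + k * m
      covered-bound = begin
        covered T                                   ≡⟨ length-concatMap-copyVertices Ks ⟩
        k * length Ks                               ≤⟨ *-monoʳ-≤ k (length-oldCopies Ks) ⟩
        k * (length (oldCopies Ks) + newTotal)      ≡⟨ *-distribˡ-+ k (length (oldCopies Ks)) newTotal ⟩
        k * length (oldCopies Ks) + k * newTotal    ≤⟨ +-mono-≤ (≤-reflexive (sym (length-concatMap-copyVertices (oldCopies Ks)))) (*-monoʳ-≤ k newTotal≤m) ⟩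
        covered T′ + k * m                          ∎
        where open ≤-Reasoning

  uncovered-restriction : ∀ {n′ n c′ c l} → n′ ≤ n → c ≤ c′ + l → n′ ∸ c′ ≤ (n ∸ c) + l
  uncovered-restriction {n′} {n} {c′} {c} {l} n′≤n c≤c′+l = m≤n+o⇒m∸n≤o n′ c′ (begin
    n′                ≤⟨ n′≤n ⟩
    n                 ≤⟨ m≤n+m∸n n c ⟩
    c + (n ∸ c)       ≤⟨ +-monoˡ-≤ (n ∸ c) c≤c′+l ⟩
    c′ + l + (n ∸ c)  ≡⟨ +-assoc c′ l (n ∸ c) ⟩
    c′ + (l + (n ∸ c)) ≡⟨ cong (c′ +_) (+-comm l (n ∸ c)) ⟩
    c′ + ((n ∸ c) + l) ∎)
    where open ≤-Reasoning

module Arithmetic where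

  open import Data.Nat as ℕ using (ℕ; zero; suc; z≤n)
  open import Data.Nat.Properties using (≤-refl; +-comm; m≤m*n)
  open import Data.Product using (_×_; _,_; proj₁; proj₂; ∃)
  open import Relation.Binary.PropositionalEquality
  open import Relation.Nullary using (yes; no)

  open import Data.Integer as ℤ using (+_; +≤+)
  import Data.Integer.Properties as ℤ
  import Data.Nat.Coprimality as Coprime
  open import Data.Rational using (ℚ; mkℚ; _/_; _+_; _*_; _-_; -_; 1ℚ; 0ℚ; _≤_; _<_; *≤*; NonZero; 1/_)
  import Data.Rational as ℚ
  import Data.Rational.Properties as ℚ
  open import Data.Rational.Solver using (module +-*-Solver)
  open +-*-Solver

  ℕ→ℚ≡mkℚ : ∀ n → ℕ→ℚ n ≡ mkℚ (+ n) 0 (Coprime.sym (Coprime.1-coprimeTo n))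
  ℕ→ℚ≡mkℚ n = ℚ.↥p/↧p≡p (mkℚ (+ n) 0 (Coprime.sym (Coprime.1-coprimeTo n)))

  ℕ→ℚ-+ : ∀ m n → ℕ→ℚ (m ℕ.+ n) ≡ ℕ→ℚ m + ℕ→ℚ n
  ℕ→ℚ-+ m n rewrite ℕ→ℚ≡mkℚ m | ℕ→ℚ≡mkℚ n =
    ℚ./-cong (trans (ℤ.pos-+ m n) (sym (cong₂ ℤ._+_ (ℤ.*-identityʳ (+ m)) (ℤ.*-identityʳ (+ n))))) refl

  ℕ→ℚ-* : ∀ m n → ℕ→ℚ (m ℕ.* n) ≡ ℕ→ℚ m * ℕ→ℚ n
  ℕ→ℚ-* m n rewrite ℕ→ℚ≡mkℚ m | ℕ→ℚ≡mkℚ n = ℚ./-cong (ℤ.pos-* m n) refl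

  ℕ→ℚ-suc : ∀ n → ℕ→ℚ (suc n) ≡ ℕ→ℚ n + 1ℚ
  ℕ→ℚ-suc n = trans (cong ℕ→ℚ (+-comm 1 n)) (ℕ→ℚ-+ n 1)

  ℕ→ℚ-mono-≤ : ∀ {m n} → m ℕ.≤ n → ℕ→ℚ m ≤ ℕ→ℚ n
  ℕ→ℚ-mono-≤ {m} {n} m≤n rewrite ℕ→ℚ≡mkℚ m | ℕ→ℚ≡mkℚ n =
    *≤* (subst₂ ℤ._≤_ (sym (ℤ.*-identityʳ (+ m))) (sym (ℤ.*-identityʳ (+ n))) (+≤+ m≤n))

  0≤ℕ→ℚ : ∀ n → 0ℚ ≤ ℕ→ℚ n
  0≤ℕ→ℚ n = ℕ→ℚ-mono-≤ {0} {n} z≤n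

  0≤frac : ∀ a b → 0ℚ ≤ + a / suc b
  0≤frac a b = ℚ.nonNegative⁻¹ (+ a / suc b) {{ℚ.normalize-nonNeg a (suc b)}}

  archimedean : ∀ x → ∃ λ n → x ≤ ℕ→ℚ n
  archimedean x@(mkℚ p q-1 _) = ℤ.∣ p ∣ , subst (x ≤_) (sym (ℕ→ℚ≡mkℚ ℤ.∣ p ∣)) (*≤* (begin
    p ℤ.* + 1               ≡⟨ ℤ.*-identityʳ p ⟩
    p                       ≤⟨ i≤+∣i∣ p ⟩
    + ℤ.∣ p ∣               ≤⟨ +≤+ (m≤m*n ℤ.∣ p ∣ (suc q-1)) ⟩
    + (ℤ.∣ p ∣ ℕ.* suc q-1) ≡⟨ ℤ.pos-* ℤ.∣ p ∣ (suc q-1) ⟩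
    + ℤ.∣ p ∣ ℤ.* + suc q-1 ∎))
    where
    open ℤ.≤-Reasoning
    i≤+∣i∣ : ∀ i → i ℤ.≤ + ℤ.∣ i ∣
    i≤+∣i∣ (+ n)      = +≤+ ≤-refl
    i≤+∣i∣ ℤ.-[1+ n ] = ℤ.-≤+

  natCeiling : ∀ x → 0ℚ ≤ x → ∃ λ n → x ≤ ℕ→ℚ n × ℕ→ℚ n ≤ x + 1ℚ
  natCeiling x 0≤x = search (proj₁ (archimedean x)) (proj₂ (archimedean x))
    where
    search : ∀ n → x ≤ ℕ→ℚ n → ∃ λ n → x ≤ ℕ→ℚ n × ℕ→ℚ n ≤ x + 1ℚ
    search zero    x≤0 = 0 , x≤0 , ℚ.≤-trans 0≤x (ℚ.≤-trans (ℚ.≤-reflexive (sym (ℚ.+-identityʳ x))) (ℚ.+-monoʳ-≤ x (0≤frac 1 0)))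
    search (suc n) x≤1+n with x ℚ.≤? ℕ→ℚ n
    ... | yes x≤n = search n x≤n
    ... | no  x≰n = suc n , x≤1+n , subst (_≤ x + 1ℚ) (sym (ℕ→ℚ-suc n))
                                            (ℚ.+-monoˡ-≤ 1ℚ (ℚ.<⇒≤ (ℚ.≰⇒> x≰n)))

  eventually-≤ : ∀ {ρ} → 0ℚ < ρ → ∀ c → ∃ λ n₀ → ∀ n → n₀ ℕ.≤ n → c ≤ ρ * ℕ→ℚ n
  eventually-≤ {ρ} 0<ρ c = n₀ , λ n n₀≤n → begin
    c              ≡⟨ sym ρ*[c/ρ]≡c ⟩
    ρ * (c * 1/ ρ) ≤⟨ ℚ.*-monoˡ-≤-nonNeg ρ (proj₂ (archimedean (c * 1/ ρ))) ⟩
    ρ * ℕ→ℚ n₀     ≤⟨ ℚ.*-monoˡ-≤-nonNeg ρ (ℕ→ℚ-mono-≤ n₀≤n) ⟩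
    ρ * ℕ→ℚ n      ∎
    where
    open ℚ.≤-Reasoning
    instance
      ρ≢0 : NonZero ρ
      ρ≢0 = ℚ.>-nonZero 0<ρ
      0≤ρ : ℚ.NonNegative ρ
      0≤ρ = ℚ.nonNegative (ℚ.<⇒≤ 0<ρ)
    n₀ = proj₁ (archimedean (c * 1/ ρ))
    ρ*[c/ρ]≡c : ρ * (c * 1/ ρ) ≡ c
    ρ*[c/ρ]≡c = begin-equality
      ρ * (c * 1/ ρ) ≡⟨ cong (ρ *_) (ℚ.*-comm c (1/ ρ)) ⟩
      ρ * (1/ ρ * c) ≡⟨ sym (ℚ.*-assoc ρ (1/ ρ) c) ⟩
      ρ * 1/ ρ * c   ≡⟨ cong (_* c) (ℚ.*-inverseʳ ρ) ⟩
      1ℚ * c         ≡⟨ ℚ.*-identityˡ c ⟩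
      c              ∎

  ≤-via-gap : ∀ p r s → r ≡ p + s → 0ℚ ≤ s → p ≤ r
  ≤-via-gap p r s r≡p+s 0≤s = subst₂ _≤_ (ℚ.+-identityʳ p) (sym r≡p+s) (ℚ.+-monoʳ-≤ p 0≤s)

  p≤q⇒0≤q-p : ∀ {p q} → p ≤ q → 0ℚ ≤ q - p
  p≤q⇒0≤q-p {p} {q} p≤q = subst (_≤ q - p) (ℚ.+-inverseʳ p) (ℚ.+-monoˡ-≤ (- p) p≤q)

  0≤+ : ∀ {p q} → 0ℚ ≤ p → 0ℚ ≤ q → 0ℚ ≤ p + q
  0≤+ = ℚ.+-mono-≤

  0≤* : ∀ {p q} → 0ℚ ≤ p → 0ℚ ≤ q → 0ℚ ≤ p * q
  0≤* {p} {q} 0≤p 0≤q = subst (_≤ p * q) (ℚ.*-zeroʳ p) (ℚ.*-monoˡ-≤-nonNeg p {{ℚ.nonNegative 0≤p}} 0≤q)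

  -- Each estimate below exhibits the gap as a sum of products of nonnegative slacks of its hypotheses.

  parameters-small : ∀ {β ρ k} → 0ℚ ≤ β → 0ℚ ≤ ρ → + 3 / 1 ≤ k → β + + 2 / 1 * k * ρ ≤ 1ℚ →
                     ρ ≤ + 1 / 6 × β ≤ 1ℚ
  parameters-small {β} {ρ} {k} 0≤β 0≤ρ 3≤k γ≤1 =
    ≤-via-gap ρ (+ 1 / 6) gap₁ (solve 3 (λ β ρ k → con (+ 1 / 6) := ρ :+ gap₁′ β ρ k) refl β ρ k) 0≤gap₁ ,
    ≤-via-gap β 1ℚ gap₂ (solve 3 (λ β ρ k → con 1ℚ := β :+ gap₂′ β ρ k) refl β ρ k) 0≤gap₂
    where
    gap₁′ = λ β ρ k → con (+ 1 / 6) :* (con 1ℚ :- (β :+ con (+ 2 / 1) :* k :* ρ)) :+ con (+ 1 / 6) :* β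
                      :+ con (+ 1 / 3) :* ((k :- con (+ 3 / 1)) :* ρ)
    gap₂′ = λ β ρ k → (con 1ℚ :- (β :+ con (+ 2 / 1) :* k :* ρ)) :+ con (+ 2 / 1) :* ((k :- con (+ 3 / 1)) :* ρ)
                      :+ con (+ 6 / 1) :* ρ
    gap₁ = + 1 / 6 * (1ℚ - (β + + 2 / 1 * k * ρ)) + + 1 / 6 * β + + 1 / 3 * ((k - + 3 / 1) * ρ)
    gap₂ = (1ℚ - (β + + 2 / 1 * k * ρ)) + + 2 / 1 * ((k - + 3 / 1) * ρ) + + 6 / 1 * ρ
    0≤[k-3]ρ = 0≤* (p≤q⇒0≤q-p 3≤k) 0≤ρ
    0≤gap₁ = 0≤+ (0≤+ (0≤* (0≤frac 1 5) (p≤q⇒0≤q-p γ≤1)) (0≤* (0≤frac 1 5) 0≤β)) (0≤* (0≤frac 1 2) 0≤[k-3]ρ)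
    0≤gap₂ = 0≤+ (0≤+ (p≤q⇒0≤q-p γ≤1) (0≤* (0≤frac 2 0) 0≤[k-3]ρ)) (0≤* (0≤frac 6 0) 0≤ρ)

  module _ {d ρ N m : ℚ} (d≤3/5 : d ≤ + 3 / 5) (0≤ρ : 0ℚ ≤ ρ) (ρ≤1/6 : ρ ≤ + 1 / 6) (5≤N : + 5 / 1 ≤ N)
           (m-large : + 5 / 4 * ρ * (N + 1ℚ) + + 2 / 1 ≤ m) where

    cone-gain-estimate : ∀ {c} → 0ℚ ≤ c → ρ * (+ 1 / 2 * ((N + 1ℚ) * N)) + d * ((N + 1ℚ) * m + c) ≤ m * N + c
    cone-gain-estimate {c} 0≤c = ≤-via-gap _ _ gap identity 0≤gap
      where
      A = + 3 / 5 - d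
      B = N - + 5 / 1
      D = m - (+ 5 / 4 * ρ * (N + 1ℚ) + + 2 / 1)
      E = + 1 / 6 - ρ
      gap = A * ((N + 1ℚ) * m) + (A + + 2 / 5) * c + (+ 2 / 5 * B + + 7 / 5) * D + + 3 / 4 * (N + 1ℚ) * E
            + + 27 / 40 * B + + 41 / 20
      identity : m * N + c ≡ (ρ * (+ 1 / 2 * ((N + 1ℚ) * N)) + d * ((N + 1ℚ) * m + c)) + gap
      identity = solve 5 (λ d ρ N m c →
        m :* N :+ c := (ρ :* (con (+ 1 / 2) :* ((N :+ con 1ℚ) :* N)) :+ d :* ((N :+ con 1ℚ) :* m :+ c))
          :+ ((con (+ 3 / 5) :- d) :* ((N :+ con 1ℚ) :* m) :+ ((con (+ 3 / 5) :- d) :+ con (+ 2 / 5)) :* c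
             :+ (con (+ 2 / 5) :* (N :- con (+ 5 / 1)) :+ con (+ 7 / 5)) :* (m :- (con (+ 5 / 4) :* ρ :* (N :+ con 1ℚ) :+ con (+ 2 / 1)))
             :+ con (+ 3 / 4) :* (N :+ con 1ℚ) :* (con (+ 1 / 6) :- ρ) :+ con (+ 27 / 40) :* (N :- con (+ 5 / 1))
             :+ con (+ 41 / 20))) refl d ρ N m c
      0≤A = p≤q⇒0≤q-p d≤3/5
      0≤B = p≤q⇒0≤q-p 5≤N
      0≤N+1 = 0≤+ (ℚ.≤-trans (0≤frac 5 0) 5≤N) (0≤frac 1 0)
      0≤m = ℚ.≤-trans (0≤+ (0≤* (0≤* (0≤frac 5 3) 0≤ρ) 0≤N+1) (0≤frac 2 0)) m-large
      0≤gap = 0≤+ (0≤+ (0≤+ (0≤+ (0≤+ (0≤* 0≤A (0≤* 0≤N+1 0≤m)) (0≤* (0≤+ 0≤A (0≤frac 2 4)) 0≤c))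
                (0≤* (0≤+ (0≤* (0≤frac 2 4) 0≤B) (0≤frac 7 4)) (p≤q⇒0≤q-p m-large)))
                (0≤* (0≤* (0≤frac 3 3) 0≤N+1) (p≤q⇒0≤q-p ρ≤1/6)))
                (0≤* (0≤frac 27 39) 0≤B)) (0≤frac 41 19)

    old-vertex-estimate : ∀ {c D} → 0ℚ ≤ c → (d - ρ) * (+ 1 / 2 * ((N + 1ℚ) * N)) ≤ D →
                          d * (+ 1 / 2 * ((N + 1ℚ) * N) + (N + 1ℚ) * m + c) ≤ D + (m * N + c)
    old-vertex-estimate {c} {D} 0≤c D-large = begin
      d * (X + (N + 1ℚ) * m + c)                    ≡⟨ solve 5 (λ d ρ X Nm c → d :* (X :+ Nm :+ c) := (d :- ρ) :* X :+ (ρ :* X :+ d :* (Nm :+ c)))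
                                                                refl d ρ X ((N + 1ℚ) * m) c ⟩
      (d - ρ) * X + (ρ * X + d * ((N + 1ℚ) * m + c)) ≤⟨ ℚ.+-mono-≤ D-large (cone-gain-estimate 0≤c) ⟩
      D + (m * N + c)                               ∎
      where
      open ℚ.≤-Reasoning
      X = + 1 / 2 * ((N + 1ℚ) * N)

  new-vertex-estimate : ∀ {d X Y} → d ≤ + 3 / 5 → 0ℚ ≤ X → + 3 / 1 * X ≤ + 5 / 1 * Y → d * X ≤ Y
  new-vertex-estimate {d} {X} {Y} d≤3/5 0≤X 3X≤5Y = begin
    d * X                   ≤⟨ ℚ.*-monoʳ-≤-nonNeg X {{ℚ.nonNegative 0≤X}} d≤3/5 ⟩
    + 3 / 5 * X             ≡⟨ solve 1 (λ X → con (+ 3 / 5) :* X := con (+ 1 / 5) :* (con (+ 3 / 1) :* X)) refl X ⟩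
    + 1 / 5 * (+ 3 / 1 * X) ≤⟨ ℚ.*-monoˡ-≤-nonNeg (+ 1 / 5) {{ℚ.nonNegative (0≤frac 1 4)}} 3X≤5Y ⟩
    + 1 / 5 * (+ 5 / 1 * Y) ≡⟨ solve 1 (λ Y → con (+ 1 / 5) :* (con (+ 5 / 1) :* Y) := Y) refl Y ⟩
    Y                       ∎
    where open ℚ.≤-Reasoning

  deficiency-estimate : ∀ {β ρ k n m U W} → W ≤ U + k * m → U ≤ β * (n + m) → β ≤ 1ℚ → + 3 / 1 ≤ k →
                        0ℚ ≤ m → m ≤ + 5 / 4 * ρ * n + + 2 / 1 + 1ℚ → + 24 / 1 ≤ ρ * n →
                        W ≤ (β + + 2 / 1 * k * ρ) * n
  deficiency-estimate {β} {ρ} {k} {n} {m} {U} {W} W≤U+km U≤β[n+m] β≤1 3≤k 0≤m m-small ρn-large = begin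
    W                      ≤⟨ W≤U+km ⟩
    U + k * m              ≤⟨ ℚ.+-monoˡ-≤ (k * m) U≤β[n+m] ⟩
    β * (n + m) + k * m    ≤⟨ ≤-via-gap _ _ gap identity 0≤gap ⟩
    (β + + 2 / 1 * k * ρ) * n ∎
    where
    open ℚ.≤-Reasoning
    gap = (1ℚ - β) * m + (k + 1ℚ) * ((+ 5 / 4 * ρ * n + + 2 / 1 + 1ℚ) - m) + + 3 / 4 * ((k - + 3 / 1) * (ρ * n - + 24 / 1))
          + (ρ * n - + 24 / 1) + + 15 / 1 * (k - + 3 / 1) + + 12 / 1
    identity : (β + + 2 / 1 * k * ρ) * n ≡ β * (n + m) + k * m + gap
    identity = solve 5 (λ β ρ k n m → (β :+ con (+ 2 / 1) :* k :* ρ) :* n := β :* (n :+ m) :+ k :* m :+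
      ((con 1ℚ :- β) :* m :+ (k :+ con 1ℚ) :* ((con (+ 5 / 4) :* ρ :* n :+ con (+ 2 / 1) :+ con 1ℚ) :- m)
       :+ con (+ 3 / 4) :* ((k :- con (+ 3 / 1)) :* (ρ :* n :- con (+ 24 / 1)))
       :+ (ρ :* n :- con (+ 24 / 1)) :+ con (+ 15 / 1) :* (k :- con (+ 3 / 1)) :+ con (+ 12 / 1))) refl β ρ k n m
    0≤k+1 = ℚ.≤-trans (0≤frac 4 0) (ℚ.+-monoˡ-≤ 1ℚ 3≤k)
    0≤gap = 0≤+ (0≤+ (0≤+ (0≤+ (0≤+ (0≤* (p≤q⇒0≤q-p β≤1) 0≤m) (0≤* 0≤k+1 (p≤q⇒0≤q-p m-small)))
              (0≤* (0≤frac 3 3) (0≤* (p≤q⇒0≤q-p 3≤k) (p≤q⇒0≤q-p ρn-large)))) (p≤q⇒0≤q-p ρn-large))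
              (0≤* (0≤frac 15 0) (p≤q⇒0≤q-p 3≤k))) (0≤frac 12 0)

open import Data.Integer using (+_)
open import Data.Nat as ℕ using (ℕ; suc; _≤_; _>_; _⊔_; _+_; s≤s)
import Data.Nat.Properties as ℕ
open import Data.Nat.Combinatorics using (_C_)
open import Data.Rational as ℚ using (ℚ; 0ℚ; 1ℚ; _/_)
import Data.Rational.Properties as ℚ
open import Data.Bool using (true; false)
open import Data.List using ([])
open import Data.List.Relation.Unary.AllPairs using ([])
open import Data.Product using (Σ; ∃; _×_; _,_; proj₁; proj₂)
open import Relation.Binary.PropositionalEquality
open import Relation.Nullary using (yes; no)
open import Function using (_∘_)
open import Data.Rational.Solver using (module +-*-Solver)
open +-*-Solver
open Combinatorics
open Arithmetic

ℕ→ℚ-[1+n]C2 : ∀ n → ℕ→ℚ (suc n C 2) ≡ + 1 / 2 ℚ.* ((ℕ→ℚ n ℚ.+ 1ℚ) ℚ.* ℕ→ℚ n)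
ℕ→ℚ-[1+n]C2 n = begin
  ℕ→ℚ (suc n C 2)                            ≡⟨ solve 1 (λ x → x := con (+ 1 / 2) :* (con (+ 2 / 1) :* x)) refl (ℕ→ℚ (suc n C 2)) ⟩
  + 1 / 2 ℚ.* (+ 2 / 1 ℚ.* ℕ→ℚ (suc n C 2))  ≡⟨ cong (+ 1 / 2 ℚ.*_) (sym (ℕ→ℚ-* 2 (suc n C 2))) ⟩
  + 1 / 2 ℚ.* ℕ→ℚ (2 ℕ.* (suc n C 2))        ≡⟨ cong (λ t → + 1 / 2 ℚ.* ℕ→ℚ t) (2*[1+n]C2≡[1+n]*n n) ⟩
  + 1 / 2 ℚ.* ℕ→ℚ (suc n ℕ.* n)              ≡⟨ cong (+ 1 / 2 ℚ.*_) (trans (ℕ→ℚ-* (suc n) n) (cong (ℚ._* ℕ→ℚ n) (ℕ→ℚ-suc n))) ⟩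
  + 1 / 2 ℚ.* ((ℕ→ℚ n ℚ.+ 1ℚ) ℚ.* ℕ→ℚ n)    ∎
  where open ≡-Reasoning

module _ {N : ℕ} (H : Graph3 (suc N)) where

  open Tower H

  ℕ→ℚ-[1+m+N]C2 : ∀ m → ℕ→ℚ (suc (m + N) C 2) ≡
    + 1 / 2 ℚ.* ((ℕ→ℚ N ℚ.+ 1ℚ) ℚ.* ℕ→ℚ N) ℚ.+ (ℕ→ℚ N ℚ.+ 1ℚ) ℚ.* ℕ→ℚ m ℚ.+ ℕ→ℚ (m C 2)
  ℕ→ℚ-[1+m+N]C2 m = begin
    ℕ→ℚ (suc (m + N) C 2)
      ≡⟨ cong (λ t → ℕ→ℚ (t C 2)) (sym (ℕ.+-suc m N)) ⟩
    ℕ→ℚ ((m + suc N) C 2)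
      ≡⟨ cong ℕ→ℚ ([m+n]C2≡nC2+n*m+mC2 m (suc N)) ⟩
    ℕ→ℚ (suc N C 2 + suc N ℕ.* m + m C 2)
      ≡⟨ trans (ℕ→ℚ-+ (suc N C 2 + suc N ℕ.* m) (m C 2)) (cong (ℚ._+ ℕ→ℚ (m C 2)) (trans (ℕ→ℚ-+ (suc N C 2) (suc N ℕ.* m)) (cong (ℕ→ℚ (suc N C 2) ℚ.+_) (ℕ→ℚ-* (suc N) m)))) ⟩
    ℕ→ℚ (suc N C 2) ℚ.+ ℕ→ℚ (suc N) ℚ.* ℕ→ℚ m ℚ.+ ℕ→ℚ (m C 2)
      ≡⟨ cong₂ (λ s t → s ℚ.+ t ℚ.* ℕ→ℚ m ℚ.+ ℕ→ℚ (m C 2)) (ℕ→ℚ-[1+n]C2 N) (ℕ→ℚ-suc N) ⟩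
    + 1 / 2 ℚ.* ((ℕ→ℚ N ℚ.+ 1ℚ) ℚ.* ℕ→ℚ N) ℚ.+ (ℕ→ℚ N ℚ.+ 1ℚ) ℚ.* ℕ→ℚ m ℚ.+ ℕ→ℚ (m C 2) ∎
    where open ≡-Reasoning

  module _ {d : ℚ} (m : ℕ) (d≤3/5 : d ℚ.≤ + 3 / 5) (5≤N : 5 ≤ N) where

    new-vertex-degree : ∀ v → isNew m v ≡ true → d ℚ.* ℕ→ℚ (suc (m + N) C 2) ℚ.≤ ℕ→ℚ (degree (tower m) v)
    new-vertex-degree v v-new = new-vertex-estimate d≤3/5 (0≤ℕ→ℚ (suc (m + N) C 2))
      (subst₂ ℚ._≤_ (ℕ→ℚ-* 3 (suc (m + N) C 2)) (ℕ→ℚ-* 5 (degree (tower m) v)) (ℕ→ℚ-mono-≤ 3C≤5C))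
      where
      3C≤5C : 3 ℕ.* (suc (m + N) C 2) ≤ 5 ℕ.* degree (tower m) v
      3C≤5C = subst (λ t → 3 ℕ.* (suc (m + N) C 2) ≤ 5 ℕ.* t) (sym (degree-new m v v-new))
                    (3*[1+n]C2≤5*nC2 (m + N) (ℕ.≤-trans 5≤N (ℕ.m≤n+m N m)))

    module _ {ρ : ℚ} (0≤ρ : 0ℚ ℚ.≤ ρ) (ρ≤1/6 : ρ ℚ.≤ + 1 / 6)
             (m-large : + 5 / 4 ℚ.* ρ ℚ.* (ℕ→ℚ N ℚ.+ 1ℚ) ℚ.+ + 2 / 1 ℚ.≤ ℕ→ℚ m)
             (δH : δ₁≥ H ((d ℚ.- ρ) ℚ.* ℕ→ℚ (suc N C 2))) where

      old-vertex-degree : ∀ u → d ℚ.* ℕ→ℚ (suc (m + N) C 2) ℚ.≤ ℕ→ℚ (degree (tower m) (embed m u))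
      old-vertex-degree u = subst₂ (λ s t → d ℚ.* s ℚ.≤ t) (sym (ℕ→ℚ-[1+m+N]C2 m)) (sym degree-eq)
        (old-vertex-estimate d≤3/5 0≤ρ ρ≤1/6 (ℕ→ℚ-mono-≤ {5} {N} 5≤N) m-large (0≤ℕ→ℚ (m C 2))
          (subst (λ t → (d ℚ.- ρ) ℚ.* t ℚ.≤ ℕ→ℚ (degree H u)) (ℕ→ℚ-[1+n]C2 N) (δH u)))
        where
        degree-eq : ℕ→ℚ (degree (tower m) (embed m u)) ≡ ℕ→ℚ (degree H u) ℚ.+ (ℕ→ℚ m ℚ.* ℕ→ℚ N ℚ.+ ℕ→ℚ (m C 2))
        degree-eq = begin
          ℕ→ℚ (degree (tower m) (embed m u))                        ≡⟨ cong ℕ→ℚ (degree-embed m u) ⟩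
          ℕ→ℚ (degree H u + (m ℕ.* N + m C 2))                      ≡⟨ ℕ→ℚ-+ (degree H u) (m ℕ.* N + m C 2) ⟩
          ℕ→ℚ (degree H u) ℚ.+ ℕ→ℚ (m ℕ.* N + m C 2)                ≡⟨ cong (ℕ→ℚ (degree H u) ℚ.+_) (ℕ→ℚ-+ (m ℕ.* N) (m C 2)) ⟩
          ℕ→ℚ (degree H u) ℚ.+ (ℕ→ℚ (m ℕ.* N) ℚ.+ ℕ→ℚ (m C 2))      ≡⟨ cong (λ t → ℕ→ℚ (degree H u) ℚ.+ (t ℚ.+ ℕ→ℚ (m C 2))) (ℕ→ℚ-* m N) ⟩
          ℕ→ℚ (degree H u) ℚ.+ (ℕ→ℚ m ℚ.* ℕ→ℚ N ℚ.+ ℕ→ℚ (m C 2))   ∎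
          where open ≡-Reasoning

      tower-minDegree : δ₁≥ (tower m) (d ℚ.* ℕ→ℚ (suc (m + N) C 2))
      tower-minDegree v = by-kind (isNew m v) refl
        where
        by-kind : ∀ b → isNew m v ≡ b → d ℚ.* ℕ→ℚ (suc (m + N) C 2) ℚ.≤ ℕ→ℚ (degree (tower m) v)
        by-kind true  v-new = new-vertex-degree v v-new
        by-kind false v-old = subst (λ w → d ℚ.* ℕ→ℚ (suc (m + N) C 2) ℚ.≤ ℕ→ℚ (degree (tower m) w))
                                    (embed-retract m v v-old) (old-vertex-degree (retract m v))

  module _ {a b c : ℕ} {d β ρ : ℚ} (3≤k : 3 ≤ a + b + c) (d≤3/5 : d ℚ.≤ + 3 / 5) (0≤β : 0ℚ ℚ.≤ β) (0≤ρ : 0ℚ ℚ.≤ ρ)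
           (γ≤1 : β ℚ.+ + 2 / 1 ℚ.* ℕ→ℚ (a + b + c) ℚ.* ρ ℚ.≤ 1ℚ) (5≤N : 5 ≤ N) (ρn-large : + 24 / 1 ℚ.≤ ρ ℚ.* ℕ→ℚ (suc N))
           (tile : ∀ m (G : Graph3 (suc (m + N))) → δ₁≥ G (d ℚ.* ℕ→ℚ (suc (m + N) C 2)) → HasDeficientTiling G a b c β)
           (δH : δ₁≥ H ((d ℚ.- ρ) ℚ.* ℕ→ℚ (suc N C 2))) where

    private
      k = a + b + c
      x = + 5 / 4 ℚ.* ρ ℚ.* (ℕ→ℚ N ℚ.+ 1ℚ) ℚ.+ + 2 / 1

    tiling-from-tower : (m : ℕ) → x ℚ.≤ ℕ→ℚ m → ℕ→ℚ m ℚ.≤ x ℚ.+ 1ℚ →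
                        HasDeficientTiling H a b c (β ℚ.+ + 2 / 1 ℚ.* ℕ→ℚ k ℚ.* ρ)
    tiling-from-tower m m-large m-small = T′ ,
      deficiency-estimate uncovered-bound T-deficient β≤1 (ℕ→ℚ-mono-≤ {3} {k} 3≤k) (0≤ℕ→ℚ m) m-small′ ρn-large
      where
      ρ≤1/6 = proj₁ (parameters-small 0≤β 0≤ρ (ℕ→ℚ-mono-≤ {3} {k} 3≤k) γ≤1)
      β≤1 = proj₂ (parameters-small 0≤β 0≤ρ (ℕ→ℚ-mono-≤ {3} {k} 3≤k) γ≤1)
      m-small′ : ℕ→ℚ m ℚ.≤ + 5 / 4 ℚ.* ρ ℚ.* ℕ→ℚ (suc N) ℚ.+ + 2 / 1 ℚ.+ 1ℚ
      m-small′ = subst (λ t → ℕ→ℚ m ℚ.≤ + 5 / 4 ℚ.* ρ ℚ.* t ℚ.+ + 2 / 1 ℚ.+ 1ℚ) (sym (ℕ→ℚ-suc N)) m-small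
      open Restriction {H′ = H} {G = tower m} {a} {b} {c} (embed m) (isNew m) (retract m) (edge-embed m) (embed-retract m)
      tiled = tile m (tower m) (tower-minDegree m d≤3/5 5≤N 0≤ρ ρ≤1/6 m-large δH)
      T = proj₁ tiled
      restricted = restrictTiling m (length-unique-new m) T
      T′ = proj₁ restricted
      uncovered-bound : ℕ→ℚ (suc N ℕ.∸ covered T′) ℚ.≤ ℕ→ℚ (suc (m + N) ℕ.∸ covered T) ℚ.+ ℕ→ℚ k ℚ.* ℕ→ℚ m
      uncovered-bound = subst (ℕ→ℚ (suc N ℕ.∸ covered T′) ℚ.≤_) (trans (ℕ→ℚ-+ (suc (m + N) ℕ.∸ covered T) (k ℕ.* m)) (cong (ℕ→ℚ (suc (m + N) ℕ.∸ covered T) ℚ.+_) (ℕ→ℚ-* k m)))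
                          (ℕ→ℚ-mono-≤ (uncovered-restriction (s≤s (ℕ.m≤n+m N m)) (proj₂ restricted)))
      T-deficient : ℕ→ℚ (suc (m + N) ℕ.∸ covered T) ℚ.≤ β ℚ.* (ℕ→ℚ (suc N) ℚ.+ ℕ→ℚ m)
      T-deficient = subst (λ t → ℕ→ℚ (suc (m + N) ℕ.∸ covered T) ℚ.≤ β ℚ.* t)
                          (trans (cong (ℕ→ℚ ∘ suc) (ℕ.+-comm m N)) (ℕ→ℚ-+ (suc N) m)) (proj₂ tiled)

    padded-tiling : HasDeficientTiling H a b c (β ℚ.+ + 2 / 1 ℚ.* ℕ→ℚ k ℚ.* ρ)
    padded-tiling = from-ceiling (natCeiling x (0≤+ (0≤* (0≤* (0≤frac 5 3) 0≤ρ) (0≤+ (0≤ℕ→ℚ N) (0≤frac 1 0))) (0≤frac 2 0)))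
      where
      from-ceiling : (∃ λ m → x ℚ.≤ ℕ→ℚ m × ℕ→ℚ m ℚ.≤ x ℚ.+ 1ℚ) → HasDeficientTiling H a b c (β ℚ.+ + 2 / 1 ℚ.* ℕ→ℚ k ℚ.* ρ)
      from-ceiling (m , m-large , m-small) = tiling-from-tower m m-large m-small

emptyTiling : ∀ {n} (H : Graph3 n) (a b c : ℕ) → Tiling H a b c
emptyTiling H a b c = record { copies = [] ; disjoint = [] }

-- The empty tiling is γ-deficient as soon as γ ≥ 1.
deficientTiling-if-<1 : ∀ {n} (H : Graph3 n) (a b c : ℕ) {γ} →
                        (γ ℚ.< 1ℚ → HasDeficientTiling H a b c γ) → HasDeficientTiling H a b c γ
deficientTiling-if-<1 {n} H a b c {γ} tiling-if-<1 with 1ℚ ℚ.≤? γ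
... | no  1≰γ = tiling-if-<1 (ℚ.≰⇒> 1≰γ)
... | yes 1≤γ = emptyTiling H a b c ,
  subst (ℚ._≤ γ ℚ.* ℕ→ℚ n) (ℚ.*-identityˡ (ℕ→ℚ n)) (ℚ.*-monoʳ-≤-nonNeg (ℕ→ℚ n) {{ℚ.nonNegative (0≤ℕ→ℚ n)}} 1≤γ)

proposition4p8 : (a b c : ℕ) → 1 ≤ a → a ≤ b → b ≤ c →
    (d β ρ : ℚ) → 0ℚ ℚ.< d → d ℚ.≤ (+ 3 / 5) → 0ℚ ℚ.< β → 0ℚ ℚ.< ρ →
    Σ ℕ λ n₀ →
      ((n : ℕ) → n > n₀ → (H : Graph3 n) →
        δ₁≥ H (d ℚ.* ℕ→ℚ (n C 2)) → HasDeficientTiling H a b c β) →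
      (n′ : ℕ) → n′ > (n₀ ⊔ 5) → (H′ : Graph3 n′) →
        δ₁≥ H′ ((d ℚ.- ρ) ℚ.* ℕ→ℚ (n′ C 2)) →
        HasDeficientTiling H′ a b c (β ℚ.+ ℕ→ℚ (2 ℕ.* (a + b + c)) ℚ.* ρ)
proposition4p8 a b c 1≤a a≤b b≤c d β ρ _ d≤3/5 0<β 0<ρ = n₀ , λ where
    tile (suc N) n₀⊔5<1+N H′ δH′ → deficientTiling-if-<1 H′ a b c λ γ<1 →
      subst (HasDeficientTiling H′ a b c) (sym γ≡)
        (padded-tiling H′ 3≤k d≤3/5 (ℚ.<⇒≤ 0<β) (ℚ.<⇒≤ 0<ρ) (subst (ℚ._≤ 1ℚ) γ≡ (ℚ.<⇒≤ γ<1))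
          (ℕ.≤-pred (ℕ.≤-trans (s≤s (ℕ.m≤n⊔m n₀ 5)) n₀⊔5<1+N))
          (ρn-large (suc N) (ℕ.≤-trans (ℕ.m≤m⊔n n₀ 5) (ℕ.<⇒≤ n₀⊔5<1+N)))
          (λ m → tile (suc (m + N)) (ℕ.≤-trans (s≤s (ℕ.m≤m⊔n n₀ 5)) (ℕ.≤-trans n₀⊔5<1+N (s≤s (ℕ.m≤n+m N m)))))
          δH′)
  where
  n₀ = proj₁ (eventually-≤ 0<ρ (+ 24 / 1))
  ρn-large = proj₂ (eventually-≤ 0<ρ (+ 24 / 1))
  γ≡ : β ℚ.+ ℕ→ℚ (2 ℕ.* (a + b + c)) ℚ.* ρ ≡ β ℚ.+ + 2 / 1 ℚ.* ℕ→ℚ (a + b + c) ℚ.* ρ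
  γ≡ = cong (λ t → β ℚ.+ t ℚ.* ρ) (ℕ→ℚ-* 2 (a + b + c))
  3≤k : 3 ≤ a + b + c
  3≤k = ℕ.+-mono-≤ (ℕ.+-mono-≤ 1≤a (ℕ.≤-trans 1≤a a≤b)) (ℕ.≤-trans 1≤a (ℕ.≤-trans a≤b b≤c))
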